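{- Let $n$ be an even positive integer and $1\le k\le n-1$. For integers $m\ge1$ and $j$, let $\mathcal{P}_{m,j}$ denote the number of parity alternating permutations of $[m]$ with exactly $j$ ascents, and $\mathcal{N}_{m,j}$ the number of permutations of $[m]$ with exactly $j$ ascents that are not parity alternating. Then \[ \mathcal{P}_{n,k}=(n-k)\mathcal{P}_{n-1,k-1}+(k+1)\mathcal{P}_{n-1,k},\qquad \mathcal{N}_{n,k}=(n-k)\mathcal{N}_{n-1,k-1}+(k+1)\mathcal{N}_{n-1,k}. \]
   Context: A permutation $a_1a_2\cdots a_m$ of $[m]=\{1,\dots,m\}$ (one-line notation) is parity alternating if $a_i$ and $a_{i+1}$ have different parities for every $1\le i\le m-1$. An ascent is an index $i$ ($1\le i\le m-1$) with $a_i<a_{i+1}$. A permutation of $[m]$ has at most $m-1$ ascents, so counts with $j\ge m$ ascents are $0$. -}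

module Defs where

open import Data.Nat using (ℕ; zero; suc; _+_; _<ᵇ_; _≡ᵇ_)
open import Data.Nat using (_%_)
open import Data.Bool using (Bool; true; false; _∧_; not; if_then_else_)
open import Data.List using (List; []; _∷_; map; concatMap; length; filterᵇ; applyUpTo)
open import Data.Bool.ListAction using (any)

range : ℕ → List ℕ
range m = applyUpTo suc m

words : List ℕ → ℕ → List (List ℕ)
words as zero    = [] ∷ []
words as (suc ℓ) = concatMap (λ a → map (a ∷_) (words as ℓ)) as

elemᵇ : ℕ → List ℕ → Bool
elemᵇ x xs = any (λ y → x ≡ᵇ y) xs

distinctᵇ : List ℕ → Bool
distinctᵇ []       = true
distinctᵇ (x ∷ xs) = not (elemᵇ x xs) ∧ distinctᵇ xs

perms : ℕ → List (List ℕ)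
perms m = filterᵇ distinctᵇ (words (range m) m)

ascents : List ℕ → ℕ
ascents []           = 0
ascents (x ∷ [])     = 0
ascents (x ∷ y ∷ xs) = (if x <ᵇ y then 1 else 0) + ascents (y ∷ xs)

parityAlt : List ℕ → Bool
parityAlt []           = true
parityAlt (x ∷ [])     = true
parityAlt (x ∷ y ∷ xs) = not (x % 2 ≡ᵇ y % 2) ∧ parityAlt (y ∷ xs)

P : ℕ → ℕ → ℕ
P m j = length (filterᵇ (λ w → parityAlt w ∧ (ascents w ≡ᵇ j)) (perms m))

N : ℕ → ℕ → ℕ
N m j = length (filterᵇ (λ w → not (parityAlt w) ∧ (ascents w ≡ᵇ j)) (perms m))

module Submission where

-- Cutting a permutation τ of [n−1] into τ = ys zs and writing zs n ys is a bijection between cuts of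
-- permutations of [n−1] and permutations of [n]. The n cuts of τ split by ascents: a cut at the end or at
-- an ascent of τ keeps the ascent count, the other n − 1 − asc τ cuts raise it by one; so each τ with k
-- ascents contributes k + 1 permutations with k ascents, each τ with k − 1 ascents contributes n − k.
-- For even n the construction also preserves parity alternation: zs n ys is the rotation of n τ, a list
-- of even length, and a parity alternating τ of odd length n − 1 starts and ends with odd numbers.

open import Defs
open import Data.Bool using (Bool; true; false; not; _∧_; if_then_else_; T)
open import Data.Bool.Properties using (T-≡; T-∧)
open import Data.Nat
  using (ℕ; zero; suc; _+_; _*_; _∸_; _%_; _≤_; _<_; s≤s; _≡ᵇ_; _<ᵇ_; parity; ⌊_/2⌋; ⌈_/2⌉)
open import Data.Nat.Properties
  using ( ≡ᵇ⇒≡; ≡⇒≡ᵇ; <ᵇ⇒<; <⇒<ᵇ; *-zeroʳ; *-distribˡ-+; +-suc; +-comm; +-identityʳ; m+n∸n≡m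
        ; m+1+n≢m; <-asym; 1+n≰n; suc-injective; <⇒≢)
open import Data.Nat.Divisibility using (_∣_; divides)
open import Data.Nat.Tactic.RingSolver using (solve-∀)
open import Data.Parity using (Parity; 0ℙ; 1ℙ; _⁻¹)
open import Data.Parity.Properties using (_≟_; ⁻¹-involutive; p≢p⁻¹; suc-homo-⁻¹)
open import Data.List
  using (List; []; _∷_; null; _++_; map; concatMap; length; filterᵇ; applyUpTo; cartesianProductWith)
open import Data.List.Properties
  using (map-∘; filter-++; length-++; length-applyUpTo; applyUpTo-∷ʳ; ∷-injective; ++-identityʳ)
open import Data.List.Relation.Unary.All as All using (All; []; _∷_)
open import Data.List.Relation.Unary.All.Properties as Allₚ using (¬Any⇒All¬; All¬⇒¬Any)
open import Data.List.Relation.Unary.Any as Any using (here; there)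
open import Data.List.Relation.Unary.Any.Properties using (any⁺; any⁻)
open import Data.List.Relation.Unary.AllPairs as AllPairs using ([]; _∷_)
import Data.List.Relation.Unary.AllPairs.Properties as AllPairsₚ
open import Data.List.Relation.Unary.Unique.Propositional using (Unique)
import Data.List.Relation.Unary.Unique.Propositional.Properties as Uniqueₚ
open import Data.List.Membership.Propositional using (_∈_; _∉_; find; lose)
open import Data.List.Membership.Propositional.Properties
  using ( ∈-++⁺ʳ; ∈-filter⁺; ∈-filter⁻; ∈-concatMap⁺; ∈-concatMap⁻; ∈-cartesianProductWith⁺
        ; ∈-cartesianProductWith⁻; ∈-applyUpTo⁻; ∈-∃++; ∈-map⁺; ∈-map⁻)
open import Data.List.Membership.Propositional.Properties.WithK using (unique∧set⇒bag)
open import Data.List.Relation.Binary.Disjoint.Propositional using (Disjoint)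
open import Data.List.Relation.Binary.BagAndSetEquality using (∼bag⇒↭)
open import Data.List.Relation.Binary.Permutation.Propositional
  using (_↭_; ↭-sym; ↭-trans; ↭-refl; ↭-reflexive; prep; ↭⇒↭ₛ)
open import Data.List.Relation.Binary.Permutation.Propositional.Properties
  using (↭-length; filter-↭; ∈-resp-↭; shift; ++-comm; drop-∷)
open import Data.Product using (∃; _×_; _,_; proj₁; proj₂; map₁)
open import Data.Empty using (⊥-elim)
open import Data.Unit using (⊤; tt)
open import Function using (_∘_; _∘₂_; _⇔_; mk⇔; Equivalence)
open import Relation.Nullary using (¬_)
open import Relation.Nullary.Decidable using (T?; does; dec-true; dec-false)
open import Relation.Binary.PropositionalEquality
  using (_≡_; _≢_; refl; sym; trans; cong; cong₂; subst; setoid; module ≡-Reasoning)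
open import Data.List.Relation.Binary.Permutation.Setoid.Properties (setoid ℕ) using (Unique-resp-↭)

private variable
  A B : Set
  xs ys : List A

bit : Bool → ℕ
bit b = if b then 1 else 0

count : (A → Bool) → List A → ℕ
count p xs = length (filterᵇ p xs)

count-∷ : ∀ (p : A → Bool) x xs → count p (x ∷ xs) ≡ bit (p x) + count p xs
count-∷ p x xs with p x
... | true  = refl
... | false = refl

count-++ : ∀ (p : A → Bool) xs ys → count p (xs ++ ys) ≡ count p xs + count p ys
count-++ p xs ys = trans (cong length (filter-++ (T? ∘ p) xs ys)) (length-++ (filterᵇ p xs))

count-↭ : ∀ (p : A → Bool) → xs ↭ ys → count p xs ≡ count p ys
count-↭ p xs↭ys = ↭-length (filter-↭ (T? ∘ p) xs↭ys)

count-map : ∀ (p : B → Bool) (f : A → B) xs → count p (map f xs) ≡ count (p ∘ f) xs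
count-map p f [] = refl
count-map p f (x ∷ xs) with p (f x)
... | true  = cong suc (count-map p f xs)
... | false = count-map p f xs

count-cong-on : ∀ {p q : A → Bool} xs → (∀ {x} → x ∈ xs → p x ≡ q x) → count p xs ≡ count q xs
count-cong-on []       p≡q = refl
count-cong-on {p = p} {q} (x ∷ xs) p≡q with p x | q x | p≡q (here refl)
... | true  | .true  | refl = cong suc (count-cong-on xs (p≡q ∘ there))
... | false | .false | refl = count-cong-on xs (p≡q ∘ there)

count-false : ∀ (xs : List A) → count (λ _ → false) xs ≡ 0
count-false []       = refl
count-false (x ∷ xs) = count-false xs

count-concatMap : ∀ (p : B → Bool) (f : A → List B) (q r : A → Bool) a b xs →
  (∀ {x} → x ∈ xs → count p (f x) ≡ a * bit (q x) + b * bit (r x)) →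
  count p (concatMap f xs) ≡ a * count q xs + b * count r xs
count-concatMap p f q r a b []       hyp = sym (cong₂ _+_ (*-zeroʳ a) (*-zeroʳ b))
count-concatMap p f q r a b (x ∷ xs) hyp = begin
  count p (f x ++ concatMap f xs)
    ≡⟨ count-++ p (f x) (concatMap f xs) ⟩
  count p (f x) + count p (concatMap f xs)
    ≡⟨ cong₂ _+_ (hyp (here refl)) (count-concatMap p f q r a b xs (hyp ∘ there)) ⟩
  (a * bit (q x) + b * bit (r x)) + (a * count q xs + b * count r xs)
    ≡⟨ interchange (a * bit (q x)) _ _ _ ⟩
  (a * bit (q x) + a * count q xs) + (b * bit (r x) + b * count r xs)
    ≡⟨ sym (cong₂ _+_ (*-distribˡ-+ a _ _) (*-distribˡ-+ b _ _)) ⟩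
  a * (bit (q x) + count q xs) + b * (bit (r x) + count r xs)
    ≡⟨ sym (cong₂ (λ m n → a * m + b * n) (count-∷ q x xs) (count-∷ r x xs)) ⟩
  a * count q (x ∷ xs) + b * count r (x ∷ xs) ∎
  where
  open ≡-Reasoning
  interchange : ∀ a b c d → (a + b) + (c + d) ≡ (a + c) + (b + d)
  interchange = solve-∀

count-+bit : ∀ a k bs → count (λ b → a + bit b ≡ᵇ k) bs ≡
  count not bs * bit (a ≡ᵇ k) + count (λ b → b) bs * bit (suc a ≡ᵇ k)
count-+bit a k []           = sym (cong₂ _+_ (*-zeroʳ 0) (*-zeroʳ 0))
count-+bit a k (false ∷ bs) = begin
  count (λ b → a + bit b ≡ᵇ k) (false ∷ bs)
    ≡⟨ count-∷ (λ b → a + bit b ≡ᵇ k) false bs ⟩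
  bit (a + 0 ≡ᵇ k) + count (λ b → a + bit b ≡ᵇ k) bs
    ≡⟨ cong₂ (λ m n → bit (m ≡ᵇ k) + n) (+-identityʳ a) (count-+bit a k bs) ⟩
  bit (a ≡ᵇ k) + (count not bs * bit (a ≡ᵇ k) + count (λ b → b) bs * bit (suc a ≡ᵇ k))
    ≡⟨ step (bit (a ≡ᵇ k)) (bit (suc a ≡ᵇ k)) (count not bs) (count (λ b → b) bs) ⟩
  suc (count not bs) * bit (a ≡ᵇ k) + count (λ b → b) bs * bit (suc a ≡ᵇ k) ∎
  where
  open ≡-Reasoning
  step : ∀ c d m n → c + (m * c + n * d) ≡ suc m * c + n * d
  step = solve-∀
count-+bit a k (true ∷ bs) = begin
  count (λ b → a + bit b ≡ᵇ k) (true ∷ bs)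
    ≡⟨ count-∷ (λ b → a + bit b ≡ᵇ k) true bs ⟩
  bit (a + 1 ≡ᵇ k) + count (λ b → a + bit b ≡ᵇ k) bs
    ≡⟨ cong₂ (λ m n → bit (m ≡ᵇ k) + n) (+-comm a 1) (count-+bit a k bs) ⟩
  bit (suc a ≡ᵇ k) + (count not bs * bit (a ≡ᵇ k) + count (λ b → b) bs * bit (suc a ≡ᵇ k))
    ≡⟨ step (bit (a ≡ᵇ k)) (bit (suc a ≡ᵇ k)) (count not bs) (count (λ b → b) bs) ⟩
  count not bs * bit (a ≡ᵇ k) + suc (count (λ b → b) bs) * bit (suc a ≡ᵇ k) ∎
  where
  open ≡-Reasoning
  step : ∀ c d m n → d + (m * c + n * d) ≡ m * c + suc n * d
  step = solve-∀

*-bit-≡ᵇ : ∀ (f : ℕ → ℕ) m n → f m * bit (m ≡ᵇ n) ≡ f n * bit (m ≡ᵇ n)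
*-bit-≡ᵇ f m n with m ≡ᵇ n in eq
... | true  = cong (λ x → f x * 1) (≡ᵇ⇒≡ m n (subst T (sym eq) tt))
... | false = trans (*-zeroʳ (f m)) (sym (*-zeroʳ (f n)))

T-injective : ∀ {a b} → (T a → T b) → (T b → T a) → a ≡ b
T-injective {true}  {true}  _ _ = refl
T-injective {true}  {false} f _ = ⊥-elim (f tt)
T-injective {false} {true}  _ g = ⊥-elim (g tt)
T-injective {false} {false} _ _ = refl

Unique-map⁺-on : ∀ (f : A → B) {xs} → (∀ {x y} → x ∈ xs → y ∈ xs → f x ≡ f y → x ≡ y) →
  Unique xs → Unique (map f xs)
Unique-map⁺-on f inj []           = []
Unique-map⁺-on f inj (x∉ ∷ xs!) =
  Allₚ.map⁺ (All.tabulate λ y∈ fx≡fy → All.lookup x∉ y∈ (inj (here refl) (there y∈) fx≡fy))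
  ∷ Unique-map⁺-on f (λ x∈ y∈ → inj (there x∈) (there y∈)) xs!

Unique-⊆⇒↭-++ : Unique xs → (∀ {x} → x ∈ xs → x ∈ ys) → ∃ λ zs → ys ↭ xs ++ zs
Unique-⊆⇒↭-++ {xs = []}     {ys} _          _  = ys , ↭-refl
Unique-⊆⇒↭-++ {xs = x ∷ xs}      (x∉ ∷ xs!) xs⊆ with ∈-∃++ (xs⊆ (here refl))
... | ys₁ , ys₂ , refl =
  let zs , ys↭ = Unique-⊆⇒↭-++ xs! xs⊆′ in zs , ↭-trans (shift x ys₁ ys₂) (prep x ys↭)
  where
  xs⊆′ : ∀ {y} → y ∈ xs → y ∈ ys₁ ++ ys₂
  xs⊆′ y∈ with ∈-resp-↭ (shift x ys₁ ys₂) (xs⊆ (there y∈))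
  ... | here y≡x   = ⊥-elim (All.lookup x∉ y∈ (sym y≡x))
  ... | there y∈′ = y∈′

T-elemᵇ : ∀ x xs → T (elemᵇ x xs) ⇔ x ∈ xs
T-elemᵇ x xs = mk⇔ (Any.map (≡ᵇ⇒≡ x _) ∘ any⁻ (x ≡ᵇ_) xs) (any⁺ (x ≡ᵇ_) ∘ Any.map (≡⇒≡ᵇ x _))

T-distinctᵇ : ∀ xs → T (distinctᵇ xs) ⇔ Unique xs
T-distinctᵇ xs = mk⇔ (to xs) (from xs)
  where
  to : ∀ xs → T (distinctᵇ xs) → Unique xs
  to []       _ = []
  to (x ∷ xs) t with elemᵇ x xs in eq
  ... | true  = ⊥-elim t
  ... | false = ¬Any⇒All¬ xs (subst T eq ∘ Equivalence.from (T-elemᵇ x xs)) ∷ to xs t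
  from : ∀ xs → Unique xs → T (distinctᵇ xs)
  from []       _          = tt
  from (x ∷ xs) (x∉ ∷ xs!) with elemᵇ x xs in eq
  ... | true  = ⊥-elim (All¬⇒¬Any x∉ (Equivalence.to (T-elemᵇ x xs) (subst T (sym eq) tt)))
  ... | false = from xs xs!

-- Permutations of [m]

concatMap≡cartesianProductWith : ∀ {C : Set} (f : A → B → C) xs ys →
  concatMap (λ x → map (f x) ys) xs ≡ cartesianProductWith f xs ys
concatMap≡cartesianProductWith f []       ys = refl
concatMap≡cartesianProductWith f (x ∷ xs) ys = cong (map (f x) ys ++_) (concatMap≡cartesianProductWith f xs ys)

words-suc : ∀ as ℓ → words as (suc ℓ) ≡ cartesianProductWith _∷_ as (words as ℓ)
words-suc as ℓ = concatMap≡cartesianProductWith _∷_ as (words as ℓ)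

∈-words⁻ : ∀ as ℓ {w} → w ∈ words as ℓ → length w ≡ ℓ × All (_∈ as) w
∈-words⁻ as zero    (here refl) = refl , []
∈-words⁻ as (suc ℓ) w∈ with ∈-cartesianProductWith⁻ _∷_ as (words as ℓ) (subst (_ ∈_) (words-suc as ℓ) w∈)
... | a , w , a∈ , w∈′ , refl = let |w| , w⊆ = ∈-words⁻ as ℓ w∈′ in cong suc |w| , a∈ ∷ w⊆

∈-words⁺ : ∀ as {w} → All (_∈ as) w → w ∈ words as (length w)
∈-words⁺ as []                      = here refl
∈-words⁺ as {_ ∷ w} (a∈ ∷ w⊆) =
  subst (_ ∈_) (sym (words-suc as (length w))) (∈-cartesianProductWith⁺ _∷_ a∈ (∈-words⁺ as w⊆))

words-unique : ∀ {as} ℓ → Unique as → Unique (words as ℓ)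
words-unique zero    as! = [] ∷ []
words-unique {as = as} (suc ℓ) as! = subst Unique (sym (words-suc as ℓ))
  (Uniqueₚ.cartesianProductWith⁺ _∷_ ∷-injective as! (words-unique ℓ as!))

range-unique : ∀ m → Unique (range m)
range-unique m = Uniqueₚ.applyUpTo⁺₁ suc m (λ i<j _ → <⇒≢ i<j ∘ suc-injective)

∈-range⇒≤ : ∀ {m y} → y ∈ range m → y ≤ m
∈-range⇒≤ y∈ with ∈-applyUpTo⁻ suc y∈
... | i , i<m , refl = i<m

range-suc-↭ : ∀ m → range (suc m) ↭ suc m ∷ range m
range-suc-↭ m = ↭-trans (↭-reflexive (sym (applyUpTo-∷ʳ suc m))) (++-comm (range m) (suc m ∷ []))

↭-range⇒suc∉ : ∀ {m xs} → xs ↭ range m → suc m ∉ xs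
↭-range⇒suc∉ xs↭ suc∈ = 1+n≰n (∈-range⇒≤ (∈-resp-↭ xs↭ suc∈))

∈-perms : ∀ {m w} → (w ∈ perms m) ⇔ (w ↭ range m)
∈-perms {m} {w} = mk⇔ to from
  where
  to : w ∈ perms m → w ↭ range m
  to w∈ with ∈-filter⁻ (T? ∘ distinctᵇ) w∈
  ... | w∈words , distinct with ∈-words⁻ (range m) m w∈words
  ... | |w|≡m , w⊆ with Unique-⊆⇒↭-++ (Equivalence.to (T-distinctᵇ w) distinct) (All.lookup w⊆)
  ... | []    , range↭ = ↭-sym (↭-trans range↭ (↭-reflexive (++-identityʳ w)))
  ... | _ ∷ zs , range↭ = ⊥-elim (m+1+n≢m m (sym (begin
    m                              ≡⟨ sym (length-applyUpTo suc m) ⟩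
    length (range m)               ≡⟨ ↭-length range↭ ⟩
    length (w ++ _ ∷ zs)           ≡⟨ length-++ w ⟩
    length w + suc (length zs)     ≡⟨ cong (_+ suc (length zs)) |w|≡m ⟩
    m + suc (length zs)            ∎)))
    where open ≡-Reasoning
  from : w ↭ range m → w ∈ perms m
  from w↭ = ∈-filter⁺ (T? ∘ distinctᵇ)
    (subst (λ ℓ → w ∈ words (range m) ℓ) (trans (↭-length w↭) (length-applyUpTo suc m))
      (∈-words⁺ (range m) (All.tabulate (∈-resp-↭ w↭))))
    (Equivalence.from (T-distinctᵇ w) (Unique-resp-↭ (↭⇒↭ₛ (↭-sym w↭)) (range-unique m)))

perms-unique : ∀ m → Unique (perms m)
perms-unique m = Uniqueₚ.filter⁺ (T? ∘ distinctᵇ) (words-unique m (range-unique m))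

-- Inserting the maximum at a cut

splits : List A → List (List A × List A)
splits []       = ([] , []) ∷ []
splits (x ∷ xs) = ([] , x ∷ xs) ∷ map (map₁ (x ∷_)) (splits xs)

∈-splits⁻ : ∀ xs {ys zs : List A} → (ys , zs) ∈ splits xs → ys ++ zs ≡ xs
∈-splits⁻ []       (here refl) = refl
∈-splits⁻ (x ∷ xs) (here refl) = refl
∈-splits⁻ (x ∷ xs) (there s∈) with ∈-map⁻ (map₁ (x ∷_)) s∈
... | _ , s∈′ , refl = cong (x ∷_) (∈-splits⁻ xs s∈′)

∈-splits⁺ : ∀ (ys zs : List A) → (ys , zs) ∈ splits (ys ++ zs)
∈-splits⁺ []       []       = here refl
∈-splits⁺ []       (_ ∷ _)  = here refl
∈-splits⁺ (y ∷ ys) zs       = there (∈-map⁺ (map₁ (y ∷_)) (∈-splits⁺ ys zs))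

splits-unique : ∀ (xs : List A) → Unique (splits xs)
splits-unique []       = [] ∷ []
splits-unique (x ∷ xs) =
  Allₚ.map⁺ (All.universal (λ _ ()) (splits xs)) ∷ Uniqueₚ.map⁺ inj (splits-unique xs)
  where
  inj : ∀ {s t : List _ × List _} → map₁ (x ∷_) s ≡ map₁ (x ∷_) t → s ≡ t
  inj {_ , _} {_ , _} refl = refl

∈-concatMap-splits : ∀ {xss : List (List A)} {ys zs} →
  ((ys , zs) ∈ concatMap splits xss) ⇔ (ys ++ zs ∈ xss)
∈-concatMap-splits {xss = xss} {ys} {zs} = mk⇔ to from
  where
  to : (ys , zs) ∈ concatMap splits xss → ys ++ zs ∈ xss
  to s∈ with find (∈-concatMap⁻ splits s∈)
  ... | xs , xs∈ , s∈xs = subst (_∈ _) (sym (∈-splits⁻ xs s∈xs)) xs∈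
  from : ys ++ zs ∈ xss → (ys , zs) ∈ concatMap splits xss
  from ys++zs∈ = ∈-concatMap⁺ splits (lose ys++zs∈ (∈-splits⁺ ys zs))

concatMap-splits-unique : ∀ {xss : List (List A)} → Unique xss → Unique (concatMap splits xss)
concatMap-splits-unique {xss = xss} xss! = Uniqueₚ.concat⁺
  (Allₚ.map⁺ (All.universal splits-unique xss))
  (AllPairsₚ.map⁺ (AllPairs.map disjoint xss!))
  where
  disjoint : ∀ {xs ys} → xs ≢ ys → Disjoint (splits xs) (splits ys)
  disjoint {xs} {ys} xs≢ys {_ , _} (s∈xs , s∈ys) =
    xs≢ys (trans (sym (∈-splits⁻ xs s∈xs)) (∈-splits⁻ ys s∈ys))

rotateInsert : A → List A × List A → List A
rotateInsert x (ys , zs) = zs ++ x ∷ ys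

rotateInsert-↭ : ∀ (x : A) ys zs → rotateInsert x (ys , zs) ↭ x ∷ ys ++ zs
rotateInsert-↭ x ys zs = ↭-trans (shift x zs ys) (prep x (++-comm zs ys))

++-∷-injective : ∀ {x : A} zs zs′ {ys ys′} → x ∉ zs → x ∉ zs′ →
  zs ++ x ∷ ys ≡ zs′ ++ x ∷ ys′ → zs ≡ zs′ × ys ≡ ys′
++-∷-injective []       []         _   _    refl = refl , refl
++-∷-injective []       (_ ∷ _)    _   x∉zs′ refl = ⊥-elim (x∉zs′ (here refl))
++-∷-injective (_ ∷ _)  []         x∉zs _    refl = ⊥-elim (x∉zs (here refl))
++-∷-injective (z ∷ zs) (z′ ∷ zs′) x∉zs x∉zs′ eq with ∷-injective eq
... | refl , eq′ with ++-∷-injective zs zs′ (x∉zs ∘ there) (x∉zs′ ∘ there) eq′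
... | refl , refl = refl , refl

extensions : ℕ → List (List ℕ)
extensions m = map (rotateInsert (suc m)) (concatMap splits (perms m))

extensions-unique : ∀ m → Unique (extensions m)
extensions-unique m = Unique-map⁺-on (rotateInsert (suc m)) inj (concatMap-splits-unique (perms-unique m))
  where
  suc∉ : ∀ {ys zs} → (ys , zs) ∈ concatMap splits (perms m) → suc m ∉ zs
  suc∉ {ys} s∈ = ↭-range⇒suc∉ (Equivalence.to ∈-perms (Equivalence.to ∈-concatMap-splits s∈)) ∘ ∈-++⁺ʳ ys
  inj : ∀ {s t} → s ∈ concatMap splits (perms m) → t ∈ concatMap splits (perms m) →
    rotateInsert (suc m) s ≡ rotateInsert (suc m) t → s ≡ t
  inj {_ , zs} {_ , zs′} s∈ t∈ eq with ++-∷-injective zs zs′ (suc∉ s∈) (suc∉ t∈) eq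
  ... | refl , refl = refl

perms-suc-↭ : ∀ m → perms (suc m) ↭ extensions m
perms-suc-↭ m = ∼bag⇒↭ (unique∧set⇒bag (perms-unique (suc m)) (extensions-unique m) (mk⇔ to from))
  where
  max∈range : suc m ∈ range (suc m)
  max∈range = ∈-resp-↭ (↭-sym (range-suc-↭ m)) (here refl)
  to : ∀ {σ} → σ ∈ perms (suc m) → σ ∈ extensions m
  to σ∈ with ∈-∃++ (∈-resp-↭ (↭-sym (Equivalence.to ∈-perms σ∈)) max∈range)
  ... | zs , ys , refl = ∈-map⁺ (rotateInsert (suc m))
          (Equivalence.from ∈-concatMap-splits (Equivalence.from ∈-perms
            (drop-∷ (↭-trans (↭-sym (rotateInsert-↭ (suc m) ys zs))
                    (↭-trans (Equivalence.to ∈-perms σ∈) (range-suc-↭ m))))))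
  from : ∀ {σ} → σ ∈ extensions m → σ ∈ perms (suc m)
  from σ∈ with ∈-map⁻ (rotateInsert (suc m)) σ∈
  ... | (ys , zs) , s∈ , refl = Equivalence.from ∈-perms
          (↭-trans (rotateInsert-↭ (suc m) ys zs)
          (↭-trans (prep (suc m) (Equivalence.to ∈-perms (Equivalence.to ∈-concatMap-splits s∈)))
                   (↭-sym (range-suc-↭ m))))

-- Ascents

junctionAscent : List ℕ → List ℕ → Bool
junctionAscent []           _       = false
junctionAscent (y ∷ [])     []      = false
junctionAscent (y ∷ [])     (z ∷ _) = y <ᵇ z
junctionAscent (_ ∷ y ∷ ys) zs      = junctionAscent (y ∷ ys) zs

junctionAscent-[] : ∀ ys → junctionAscent ys [] ≡ false
junctionAscent-[] []           = refl
junctionAscent-[] (y ∷ [])     = refl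
junctionAscent-[] (_ ∷ y ∷ ys) = junctionAscent-[] (y ∷ ys)

ascents-++ : ∀ ys zs → ascents (ys ++ zs) ≡ ascents ys + bit (junctionAscent ys zs) + ascents zs
ascents-++ []           zs       = refl
ascents-++ (y ∷ [])     []       = refl
ascents-++ (y ∷ [])     (z ∷ zs) = refl
ascents-++ (y ∷ y′ ∷ ys) zs = begin
  bit (y <ᵇ y′) + ascents (y′ ∷ ys ++ zs)
    ≡⟨ cong (bit (y <ᵇ y′) +_) (ascents-++ (y′ ∷ ys) zs) ⟩
  bit (y <ᵇ y′) + (ascents (y′ ∷ ys) + bit (junctionAscent (y′ ∷ ys) zs) + ascents zs)
    ≡⟨ reassoc (bit (y <ᵇ y′)) (ascents (y′ ∷ ys)) _ (ascents zs) ⟩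
  bit (y <ᵇ y′) + ascents (y′ ∷ ys) + bit (junctionAscent (y′ ∷ ys) zs) + ascents zs ∎
  where
  open ≡-Reasoning
  reassoc : ∀ a b c d → a + (b + c + d) ≡ a + b + c + d
  reassoc = solve-∀

<ᵇ-max : ∀ {n y} → y < n → (n <ᵇ y) ≡ false
<ᵇ-max {n} {y} y<n with n <ᵇ y in eq
... | true  = ⊥-elim (<-asym y<n (<ᵇ⇒< n y (subst T (sym eq) tt)))
... | false = refl

junctionAscent-max : ∀ {n} ys zs → All (_< n) ys → junctionAscent ys (n ∷ zs) ≡ not (null ys)
junctionAscent-max []           zs _              = refl
junctionAscent-max (y ∷ [])     zs (y<n ∷ _)     = Equivalence.to T-≡ (<⇒<ᵇ y<n)
junctionAscent-max (_ ∷ y ∷ ys) zs (_ ∷ ys<n)    = junctionAscent-max (y ∷ ys) zs ys<n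

ascents-max-∷ : ∀ {n} ys → All (_< n) ys → ascents (n ∷ ys) ≡ ascents ys
ascents-max-∷ []       _         = refl
ascents-max-∷ (y ∷ ys) (y<n ∷ _) = cong (λ b → bit b + ascents (y ∷ ys)) (<ᵇ-max y<n)

-- Whether zs n ys, for n above all entries, has one ascent more than ys zs.
gain : List ℕ × List ℕ → Bool
gain (ys , zs) = not (null zs) ∧ not (junctionAscent ys zs)

bit-nonEmpty : ∀ ys zs → bit (not (null zs)) ≡ bit (junctionAscent ys zs) + bit (gain (ys , zs))
bit-nonEmpty ys []      rewrite junctionAscent-[] ys = refl
bit-nonEmpty ys (z ∷ zs) with junctionAscent ys (z ∷ zs)
... | true  = refl
... | false = refl

ascents-rotateInsert : ∀ {n} ys zs → All (_< n) (ys ++ zs) →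
  ascents (rotateInsert n (ys , zs)) ≡ ascents (ys ++ zs) + bit (gain (ys , zs))
ascents-rotateInsert {n} ys zs ys++zs<n = begin
  ascents (zs ++ n ∷ ys)
    ≡⟨ ascents-++ zs (n ∷ ys) ⟩
  ascents zs + bit (junctionAscent zs (n ∷ ys)) + ascents (n ∷ ys)
    ≡⟨ cong₂ (λ j a → ascents zs + bit j + a) (junctionAscent-max zs ys zs<n) (ascents-max-∷ ys ys<n) ⟩
  ascents zs + bit (not (null zs)) + ascents ys
    ≡⟨ cong (λ j → ascents zs + j + ascents ys) (bit-nonEmpty ys zs) ⟩
  ascents zs + (bit (junctionAscent ys zs) + bit (gain (ys , zs))) + ascents ys
    ≡⟨ rearrange (ascents zs) _ _ (ascents ys) ⟩
  ascents ys + bit (junctionAscent ys zs) + ascents zs + bit (gain (ys , zs))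
    ≡⟨ cong (_+ bit (gain (ys , zs))) (sym (ascents-++ ys zs)) ⟩
  ascents (ys ++ zs) + bit (gain (ys , zs)) ∎
  where
  open ≡-Reasoning
  ys<n = Allₚ.++⁻ˡ ys ys++zs<n
  zs<n = Allₚ.++⁻ʳ ys ys++zs<n
  rearrange : ∀ a j g b → a + (j + g) + b ≡ b + j + a + g
  rearrange = solve-∀

descentMarks : ℕ → List ℕ → List Bool
descentMarks x []       = false ∷ []
descentMarks x (y ∷ ys) = not (x <ᵇ y) ∷ descentMarks y ys

gains-∷ : ∀ x xs → map gain (splits (x ∷ xs)) ≡ true ∷ descentMarks x xs
gains-∷ x xs = cong (true ∷_) (trans (sym (map-∘ (splits xs))) (gains-cons x xs))
  where
  gains-cons : ∀ x xs → map (gain ∘ map₁ (x ∷_)) (splits xs) ≡ descentMarks x xs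
  gains-cons x []       = refl
  gains-cons x (y ∷ ys) = cong (not (x <ᵇ y) ∷_) (trans (sym (map-∘ (splits ys))) (gains-cons y ys))

count-not-descentMarks : ∀ x xs → count not (descentMarks x xs) ≡ suc (ascents (x ∷ xs))
count-not-descentMarks x []       = refl
count-not-descentMarks x (y ∷ ys) with x <ᵇ y
... | true  = cong suc (count-not-descentMarks y ys)
... | false = count-not-descentMarks y ys

count-id-descentMarks : ∀ x xs → count (λ b → b) (descentMarks x xs) + ascents (x ∷ xs) ≡ length xs
count-id-descentMarks x []       = refl
count-id-descentMarks x (y ∷ ys) with x <ᵇ y
... | true  = trans (+-suc _ _) (cong suc (count-id-descentMarks y ys))
... | false = cong suc (count-id-descentMarks y ys)

count-not-gains : ∀ xs → count not (map gain (splits xs)) ≡ suc (ascents xs)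
count-not-gains []       = refl
count-not-gains (x ∷ xs) = trans (cong (count not) (gains-∷ x xs)) (count-not-descentMarks x xs)

count-id-gains : ∀ xs → count (λ b → b) (map gain (splits xs)) + ascents xs ≡ length xs
count-id-gains []       = refl
count-id-gains (x ∷ xs) = trans (cong (λ bs → count (λ b → b) bs + ascents (x ∷ xs)) (gains-∷ x xs))
  (cong suc (count-id-descentMarks x xs))

count-gains : ∀ b k xs → 1 ≤ k →
  count (λ g → b ∧ (ascents xs + bit g ≡ᵇ k)) (map gain (splits xs)) ≡
  (suc (length xs) ∸ k) * bit (b ∧ (ascents xs ≡ᵇ k ∸ 1)) + suc k * bit (b ∧ (ascents xs ≡ᵇ k))
count-gains false k       xs _ = trans (count-false (map gain (splits xs)))
  (sym (cong₂ _+_ (*-zeroʳ (suc (length xs) ∸ k)) (*-zeroʳ (suc k))))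
count-gains true  (suc k) xs _ = begin
  count (λ g → a + bit g ≡ᵇ suc k) gs
    ≡⟨ count-+bit a (suc k) gs ⟩
  count not gs * bit (a ≡ᵇ suc k) + count (λ b → b) gs * bit (a ≡ᵇ k)
    ≡⟨ cong₂ (λ x y → x * bit (a ≡ᵇ suc k) + y * bit (a ≡ᵇ k)) (count-not-gains xs) ones ⟩
  suc a * bit (a ≡ᵇ suc k) + (length xs ∸ a) * bit (a ≡ᵇ k)
    ≡⟨ cong₂ _+_ (*-bit-≡ᵇ suc a (suc k)) (*-bit-≡ᵇ (length xs ∸_) a k) ⟩
  suc (suc k) * bit (a ≡ᵇ suc k) + (length xs ∸ k) * bit (a ≡ᵇ k)
    ≡⟨ +-comm (suc (suc k) * bit (a ≡ᵇ suc k)) _ ⟩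
  (length xs ∸ k) * bit (a ≡ᵇ k) + suc (suc k) * bit (a ≡ᵇ suc k) ∎
  where
  open ≡-Reasoning
  a  = ascents xs
  gs = map gain (splits xs)
  ones : count (λ b → b) gs ≡ length xs ∸ a
  ones = trans (sym (m+n∸n≡m _ a)) (cong (_∸ a) (count-id-gains xs))

-- Parity alternation

differentParity : ∀ x y → T (not (x % 2 ≡ᵇ y % 2)) ⇔ (parity y ≡ parity x ⁻¹)
differentParity (suc (suc x)) y             = differentParity x y
differentParity zero          (suc (suc y)) = differentParity zero y
differentParity (suc zero)    (suc (suc y)) = differentParity (suc zero) y
differentParity zero          zero          = mk⇔ (λ ()) (λ ())
differentParity zero          (suc zero)    = mk⇔ (λ _ → refl) (λ _ → tt)
differentParity (suc zero)    zero          = mk⇔ (λ _ → refl) (λ _ → tt)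
differentParity (suc zero)    (suc zero)    = mk⇔ (λ ()) (λ ())

Alternating : Parity → List ℕ → Set
Alternating p []       = ⊤
Alternating p (x ∷ xs) = parity x ≡ p × Alternating (p ⁻¹) xs

parityAlt-∷ : ∀ x xs → T (parityAlt (x ∷ xs)) ⇔ Alternating (parity x) (x ∷ xs)
parityAlt-∷ x []       = mk⇔ (λ _ → refl , tt) (λ _ → tt)
parityAlt-∷ x (y ∷ ys) = mk⇔ to from
  where
  to : T (parityAlt (x ∷ y ∷ ys)) → Alternating (parity x) (x ∷ y ∷ ys)
  to t with Equivalence.to T-∧ t
  ... | opposite , rest with Equivalence.to (differentParity x y) opposite
  ... | y≡x⁻¹ = refl , y≡x⁻¹ ,
    subst (λ q → Alternating (q ⁻¹) ys) y≡x⁻¹ (proj₂ (Equivalence.to (parityAlt-∷ y ys) rest))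
  from : Alternating (parity x) (x ∷ y ∷ ys) → T (parityAlt (x ∷ y ∷ ys))
  from (_ , y≡x⁻¹ , alt) = Equivalence.from T-∧ (Equivalence.from (differentParity x y) y≡x⁻¹ ,
    Equivalence.from (parityAlt-∷ y ys) (refl , subst (λ q → Alternating (q ⁻¹) ys) (sym y≡x⁻¹) alt))

parityAlt⇔Alternating : ∀ xs → T (parityAlt xs) ⇔ (∃ λ p → Alternating p xs)
parityAlt⇔Alternating []       = mk⇔ (λ _ → 0ℙ , tt) (λ _ → tt)
parityAlt⇔Alternating (x ∷ xs) = mk⇔ (λ t → parity x , Equivalence.to (parityAlt-∷ x xs) t)
  (λ { (p , alt@(x≡p , _)) →
    Equivalence.from (parityAlt-∷ x xs) (subst (λ q → Alternating q (x ∷ xs)) (sym x≡p) alt) })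

parityAlt-tail : ∀ x xs → T (parityAlt (x ∷ xs)) → T (parityAlt xs)
parityAlt-tail x []       _ = tt
parityAlt-tail x (y ∷ ys) t = proj₂ (Equivalence.to T-∧ t)

parityAfter : Parity → List ℕ → Parity
parityAfter p []       = p
parityAfter p (_ ∷ xs) = parityAfter (p ⁻¹) xs

parityAfter-++ : ∀ p xs ys → parityAfter p (xs ++ ys) ≡ parityAfter (parityAfter p xs) ys
parityAfter-++ p []       ys = refl
parityAfter-++ p (x ∷ xs) ys = parityAfter-++ (p ⁻¹) xs ys

parityAfter-even : ∀ p xs → parity (length xs) ≡ 0ℙ → parityAfter p xs ≡ p
parityAfter-even p []           _    = refl
parityAfter-even p (_ ∷ _ ∷ xs) even = trans (parityAfter-even (p ⁻¹ ⁻¹) xs even) (⁻¹-involutive p)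

Alternating-++⁻ : ∀ p xs ys → Alternating p (xs ++ ys) → Alternating p xs × Alternating (parityAfter p xs) ys
Alternating-++⁻ p []       ys alt         = tt , alt
Alternating-++⁻ p (x ∷ xs) ys (x≡p , alt) =
  let altxs , altys = Alternating-++⁻ (p ⁻¹) xs ys alt in (x≡p , altxs) , altys

Alternating-++⁺ : ∀ p xs ys → Alternating p xs → Alternating (parityAfter p xs) ys → Alternating p (xs ++ ys)
Alternating-++⁺ p []       ys _             altys = altys
Alternating-++⁺ p (x ∷ xs) ys (x≡p , altxs) altys = x≡p , Alternating-++⁺ (p ⁻¹) xs ys altxs altys

Alternating-rotate : ∀ p xs ys → parity (length (xs ++ ys)) ≡ 0ℙ →
  Alternating p (xs ++ ys) → Alternating (parityAfter p xs) (ys ++ xs)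
Alternating-rotate p xs ys even alt with Alternating-++⁻ p xs ys alt
... | altxs , altys = Alternating-++⁺ (parityAfter p xs) ys xs altys
  (subst (λ q → Alternating q xs) (sym (trans (sym (parityAfter-++ p xs ys)) (parityAfter-even p (xs ++ ys) even))) altxs)

parityAlt-rotate : ∀ xs ys → parity (length (xs ++ ys)) ≡ 0ℙ →
  parityAlt (xs ++ ys) ≡ parityAlt (ys ++ xs)
parityAlt-rotate xs ys even =
  T-injective (rotate xs ys even) (rotate ys xs (trans (cong parity (length-++-comm ys xs)) even))
  where
  length-++-comm : ∀ (xs ys : List ℕ) → length (xs ++ ys) ≡ length (ys ++ xs)
  length-++-comm xs ys = trans (length-++ xs) (trans (+-comm (length xs) _) (sym (length-++ ys)))
  rotate : ∀ xs ys → parity (length (xs ++ ys)) ≡ 0ℙ →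
    T (parityAlt (xs ++ ys)) → T (parityAlt (ys ++ xs))
  rotate xs ys even t with Equivalence.to (parityAlt⇔Alternating (xs ++ ys)) t
  ... | p , alt = Equivalence.from (parityAlt⇔Alternating (ys ++ xs))
    (parityAfter p xs , Alternating-rotate p xs ys even alt)

hasParity : Parity → ℕ → Bool
hasParity p x = does (parity x ≟ p)

count-Alternating : ∀ p xs → Alternating p xs →
  count (hasParity p) xs ≡ ⌈ length xs /2⌉ × count (hasParity (p ⁻¹)) xs ≡ ⌊ length xs /2⌋
count-Alternating p []       _           = refl , refl
count-Alternating p (x ∷ xs) (x≡p , alt) with count-Alternating (p ⁻¹) xs alt
... | cp⁻¹ , cp rewrite ⁻¹-involutive p =
  trans (count-∷ (hasParity p) x xs) (cong₂ (λ b c → bit b + c) (dec-true (parity x ≟ p) x≡p) cp) ,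
  trans (count-∷ (hasParity (p ⁻¹)) x xs)
        (cong₂ (λ b c → bit b + c) (dec-false (parity x ≟ p ⁻¹) (p≢p⁻¹ p ∘ trans (sym x≡p))) cp⁻¹)

⌊n/2⌋≢⌈n/2⌉ : ∀ n → parity n ≡ 1ℙ → ⌊ n /2⌋ ≢ ⌈ n /2⌉
⌊n/2⌋≢⌈n/2⌉ (suc zero)    _   ()
⌊n/2⌋≢⌈n/2⌉ (suc (suc n)) odd = ⌊n/2⌋≢⌈n/2⌉ n odd ∘ suc-injective

-- The starting parity of an odd-length alternating list is the one occurring ⌈ℓ/2⌉ rather than ⌊ℓ/2⌋ times.
Alternating-↭-opposite : ∀ p {xs ys} → xs ↭ ys → parity (length xs) ≡ 1ℙ →
  Alternating p xs → ¬ Alternating (p ⁻¹) ys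
Alternating-↭-opposite p {xs} {ys} xs↭ys odd altxs altys = ⌊n/2⌋≢⌈n/2⌉ (length xs) odd (begin
  ⌊ length xs /2⌋                  ≡⟨ cong ⌊_/2⌋ (↭-length xs↭ys) ⟩
  ⌊ length ys /2⌋                  ≡⟨ sym (proj₂ (count-Alternating (p ⁻¹) ys altys)) ⟩
  count (hasParity (p ⁻¹ ⁻¹)) ys   ≡⟨ cong (λ q → count (hasParity q) ys) (⁻¹-involutive p) ⟩
  count (hasParity p) ys           ≡⟨ sym (count-↭ (hasParity p) xs↭ys) ⟩
  count (hasParity p) xs           ≡⟨ proj₁ (count-Alternating p xs altxs) ⟩
  ⌈ length xs /2⌉                  ∎)
  where open ≡-Reasoning

Alternating-↭-start : ∀ {p q xs ys} → xs ↭ ys → parity (length xs) ≡ 1ℙ →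
  Alternating p xs → Alternating q ys → p ≡ q
Alternating-↭-start {0ℙ} {0ℙ} _ _ _ _ = refl
Alternating-↭-start {1ℙ} {1ℙ} _ _ _ _ = refl
Alternating-↭-start {0ℙ} {1ℙ} xs↭ys odd = ⊥-elim ∘₂ Alternating-↭-opposite 0ℙ xs↭ys odd
Alternating-↭-start {1ℙ} {0ℙ} xs↭ys odd = ⊥-elim ∘₂ Alternating-↭-opposite 1ℙ xs↭ys odd

Alternating-applyUpTo : ∀ f m → (∀ i → parity (f (suc i)) ≡ parity (f i) ⁻¹) →
  Alternating (parity (f 0)) (applyUpTo f m)
Alternating-applyUpTo f zero    _   = tt
Alternating-applyUpTo f (suc m) alt = refl ,
  subst (λ q → Alternating q (applyUpTo (f ∘ suc) m)) (alt 0) (Alternating-applyUpTo (f ∘ suc) m (alt ∘ suc))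

Alternating-range : ∀ m → Alternating 1ℙ (range m)
Alternating-range m = Alternating-applyUpTo suc m (sym ∘ suc-homo-⁻¹)

parityAlt-even-∷ : ∀ {n m xs} → parity n ≡ 0ℙ → parity m ≡ 1ℙ → xs ↭ range m →
  parityAlt (n ∷ xs) ≡ parityAlt xs
parityAlt-even-∷ {n} {m} {xs} even odd xs↭ = T-injective (parityAlt-tail n xs) extend
  where
  odd-length : parity (length xs) ≡ 1ℙ
  odd-length = trans (cong parity (trans (↭-length xs↭) (length-applyUpTo suc m))) odd
  extend : T (parityAlt xs) → T (parityAlt (n ∷ xs))
  extend t with Equivalence.to (parityAlt⇔Alternating xs) t
  ... | p , alt = Equivalence.from (parityAlt⇔Alternating (n ∷ xs)) (0ℙ , even ,
    subst (λ q → Alternating q xs) (Alternating-↭-start xs↭ odd-length alt (Alternating-range m)) alt)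

parityAlt-rotateInsert : ∀ {m} ys zs → parity (suc m) ≡ 0ℙ → ys ++ zs ↭ range m →
  parityAlt (rotateInsert (suc m) (ys , zs)) ≡ parityAlt (ys ++ zs)
parityAlt-rotateInsert {m} ys zs even τ↭ =
  trans (parityAlt-rotate zs (suc m ∷ ys) (trans (cong parity even-length) even))
        (parityAlt-even-∷ even (trans (sym (suc-homo-⁻¹ m)) (cong _⁻¹ even)) τ↭)
  where
  even-length : length (zs ++ suc m ∷ ys) ≡ suc m
  even-length = trans (↭-length (rotateInsert-↭ (suc m) ys zs))
    (cong suc (trans (↭-length τ↭) (length-applyUpTo suc m)))

-- P m k and N m k are the counts of inClass (λ b → b) k and inClass not k over perms m.
inClass : (Bool → Bool) → ℕ → List ℕ → Bool
inClass φ k w = φ (parityAlt w) ∧ (ascents w ≡ᵇ k)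

inClass-rotateInsert : ∀ φ {m} k ys zs → parity (suc m) ≡ 0ℙ → ys ++ zs ↭ range m →
  inClass φ k (rotateInsert (suc m) (ys , zs)) ≡
  φ (parityAlt (ys ++ zs)) ∧ (ascents (ys ++ zs) + bit (gain (ys , zs)) ≡ᵇ k)
inClass-rotateInsert φ {m} k ys zs even τ↭ =
  cong₂ (λ b a → φ b ∧ (a ≡ᵇ k)) (parityAlt-rotateInsert ys zs even τ↭) (ascents-rotateInsert ys zs below)
  where
  below : All (_< suc m) (ys ++ zs)
  below = All.tabulate (s≤s ∘ ∈-range⇒≤ ∘ ∈-resp-↭ τ↭)

count-inClass-rotations : ∀ φ {m} k xs → parity (suc m) ≡ 0ℙ → xs ↭ range m → 1 ≤ k →
  count (inClass φ k ∘ rotateInsert (suc m)) (splits xs) ≡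
  (suc m ∸ k) * bit (inClass φ (k ∸ 1) xs) + suc k * bit (inClass φ k xs)
count-inClass-rotations φ {m} k xs even xs↭ k≥1 = begin
  count (inClass φ k ∘ rotateInsert (suc m)) (splits xs)
    ≡⟨ count-cong-on (splits xs) pointwise ⟩
  count (shifted ∘ gain) (splits xs)
    ≡⟨ sym (count-map shifted gain (splits xs)) ⟩
  count shifted (map gain (splits xs))
    ≡⟨ count-gains (φ (parityAlt xs)) k xs k≥1 ⟩
  (suc (length xs) ∸ k) * bit (inClass φ (k ∸ 1) xs) + suc k * bit (inClass φ k xs)
    ≡⟨ cong (λ ℓ → (suc ℓ ∸ k) * bit (inClass φ (k ∸ 1) xs) + suc k * bit (inClass φ k xs))
            (trans (↭-length xs↭) (length-applyUpTo suc m)) ⟩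
  (suc m ∸ k) * bit (inClass φ (k ∸ 1) xs) + suc k * bit (inClass φ k xs) ∎
  where
  open ≡-Reasoning
  shifted : Bool → Bool
  shifted g = φ (parityAlt xs) ∧ (ascents xs + bit g ≡ᵇ k)
  pointwise : ∀ {s} → s ∈ splits xs → inClass φ k (rotateInsert (suc m) s) ≡ shifted (gain s)
  pointwise {ys , zs} s∈ with ∈-splits⁻ xs s∈
  ... | refl = inClass-rotateInsert φ k ys zs even xs↭

count-inClass-suc : ∀ φ m k → parity (suc m) ≡ 0ℙ → 1 ≤ k →
  count (inClass φ k) (perms (suc m)) ≡
  (suc m ∸ k) * count (inClass φ (k ∸ 1)) (perms m) + suc k * count (inClass φ k) (perms m)
count-inClass-suc φ m k even k≥1 = begin
  count (inClass φ k) (perms (suc m))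
    ≡⟨ count-↭ (inClass φ k) (perms-suc-↭ m) ⟩
  count (inClass φ k) (map (rotateInsert (suc m)) (concatMap splits (perms m)))
    ≡⟨ count-map (inClass φ k) (rotateInsert (suc m)) (concatMap splits (perms m)) ⟩
  count (inClass φ k ∘ rotateInsert (suc m)) (concatMap splits (perms m))
    ≡⟨ count-concatMap _ splits (inClass φ (k ∸ 1)) (inClass φ k) (suc m ∸ k) (suc k) (perms m)
         (λ xs∈ → count-inClass-rotations φ k _ even (Equivalence.to ∈-perms xs∈) k≥1) ⟩
  (suc m ∸ k) * count (inClass φ (k ∸ 1)) (perms m) + suc k * count (inClass φ k) (perms m) ∎
  where open ≡-Reasoning

parity-*2 : ∀ q → parity (q * 2) ≡ 0ℙ
parity-*2 zero    = refl
parity-*2 (suc q) = parity-*2 q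

theorem4 : (n k : ℕ) → 1 ≤ n → 2 ∣ n → 1 ≤ k → k ≤ n ∸ 1 →
    (P n k ≡ (n ∸ k) * P (n ∸ 1) (k ∸ 1) + (k + 1) * P (n ∸ 1) k)
    × (N n k ≡ (n ∸ k) * N (n ∸ 1) (k ∸ 1) + (k + 1) * N (n ∸ 1) k)
theorem4 (suc m) k _ (divides q n≡q*2) k≥1 _ = recurrence (λ b → b) , recurrence not
  where
  even : parity (suc m) ≡ 0ℙ
  even = trans (cong parity n≡q*2) (parity-*2 q)
  recurrence : ∀ φ → count (inClass φ k) (perms (suc m)) ≡
    (suc m ∸ k) * count (inClass φ (k ∸ 1)) (perms m) + (k + 1) * count (inClass φ k) (perms m)
  recurrence φ = trans (count-inClass-suc φ m k even k≥1)
    (cong (λ c → (suc m ∸ k) * count (inClass φ (k ∸ 1)) (perms m) + c * count (inClass φ k) (perms m))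
          (+-comm 1 k))
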